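{- Let $S$ be a set of integers disjoint from $\{0,1,\dots,d\}$, let $S'\subseteq S$, let $\gamma$ be a cycle in $S_d$, and let $G$ be a tree with vertex set $S'\cup\mathrm{supp}(\gamma)$ in which every edge joins a vertex of $S'$ to a vertex of $\mathrm{supp}(\gamma)$. Let $s\in S'$. If every vertex of $\mathrm{supp}(\gamma)$ adjacent to $s$ has CICPP on $(G,\gamma)$, then $s$ has CPP on $(G,\gamma)$.
   Context: $C_\gamma$ is the circle whose nodes are the elements of $\mathrm{supp}(\gamma)$ in the clockwise order given by $\gamma$; a consecutive piece is a set $\{a,\gamma(a),\dots,\gamma^{m-1}(a)\}$ (an arc of the circle). Vertices in $S'$ are called $S$-vertices, those in $\mathrm{supp}(\gamma)$ $[d]$-vertices. CPP: $s\in S'$ has CPP on $(G,\gamma)$ if, after removing $s$ and its incident edges from $G$, the sets of $[d]$-vertices of the resulting subtrees partition $C_\gamma$ into consecutive pieces. CICPP: let $\nu\in\mathrm{supp}(\gamma)$ and let $s_{j_1}<s_{j_2}<\cdots<s_{j_t}$ be the $S$-vertices adjacent to $\nu$; removing $\nu$ and its incident edges gives $t$ subtrees. $\nu$ has CICPP on $(G,\gamma)$ if (a) the $[d]$-vertex sets of these $t$ subtrees partition $C_\gamma\setminus\{\nu\}$ into consecutive pieces, and (b) when these pieces are ordered counterclockwise on $C_\gamma$ starting from $\nu$ (i.e. in the order they are met along $\gamma^{ -1}(\nu),\gamma^{ -2}(\nu),\dots$), the $m$-th piece is the $[d]$-vertex set of the subtree containing $s_{j_m}$, for every $1\le m\le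 t$. -}

module Defs where

open import Data.Nat using (ℕ; zero; suc; _<_; _≤_)
open import Data.Integer as ℤ using (ℤ)
open import Data.Fin using (Fin)
open import Data.Fin.Permutation using (Permutation′; _⟨$⟩ʳ_)
open import Data.List using (List; []; _∷_; _++_; [_]; length)
open import Data.List.Relation.Unary.Linked using (Linked)
open import Data.List.Relation.Unary.Unique.Propositional using (Unique)
open import Data.Product using (Σ; ∃; ∃-syntax; _×_; _,_)
open import Data.Empty using (⊥)
open import Data.Unit using (⊤)
open import Relation.Binary.PropositionalEquality using (_≡_; _≢_)
open import Function using (_⇔_)

-- The symmetric group S_d acts on [d] = {1,…,d}; we label [d] by Fin d
-- (i : Fin d stands for the integer toℕ i + 1).

_^[_]_ : ∀ {d} → Permutation′ d → ℕ → Fin d → Fin d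
γ ^[ zero ] x = x
γ ^[ suc k ] x = γ ⟨$⟩ʳ (γ ^[ k ] x)

Supp : ∀ {d} → Permutation′ d → Fin d → Set
Supp γ x = γ ⟨$⟩ʳ x ≢ x

IsCycle : ∀ {d} → Permutation′ d → Set
IsCycle γ = Σ _ λ a → Supp γ a × (∀ b → Supp γ b → ∃[ k ] γ ^[ k ] a ≡ b)

Consecutive : ∀ {d} → Permutation′ d → (Fin d → Set) → Set
Consecutive γ P =
  Σ _ λ a → Σ ℕ λ m → Supp γ a × 1 ≤ m ×
    (∀ x → P x ⇔ (∃[ k ] (k < m × γ ^[ k ] a ≡ x)))

data Vtx (d : ℕ) : Set where
  S-v : ℤ → Vtx d
  D-v : Fin d → Vtx d

-- The graph G is given by its (bipartite) adjacency relation Adj s ν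
-- between S-vertices s and [d]-vertices ν; Edge is the symmetric edge relation.
Edge : ∀ {d} → (ℤ → Fin d → Set) → Vtx d → Vtx d → Set
Edge Adj (S-v s) (D-v ν) = Adj s ν
Edge Adj (D-v ν) (S-v s) = Adj s ν
Edge Adj (S-v _) (S-v _) = ⊥
Edge Adj (D-v _) (D-v _) = ⊥

data Walk {d} (Adj : ℤ → Fin d → Set) (P : Vtx d → Set) : Vtx d → Vtx d → Set where
  nil  : ∀ {x} → P x → Walk Adj P x x
  cons : ∀ {x y z} → P x → Edge Adj x y → Walk Adj P y z → Walk Adj P x z

open import Data.List.Membership.Propositional using (_∈_)

InG : ∀ {d} → Permutation′ d → List ℤ → Vtx d → Set
InG γ S' (S-v s) = s ∈ S'
InG γ S' (D-v ν) = Supp γ ν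

-- G is a tree on vertex set S' ∪ supp γ: connected and acyclic
-- (a cycle = at least 3 distinct vertices v₀,…,v_k with consecutive ones adjacent
--  and v_k adjacent to v₀)
IsTree : ∀ {d} → Permutation′ d → List ℤ → (ℤ → Fin d → Set) → Set
IsTree γ S' Adj =
  (∀ u v → InG γ S' u → InG γ S' v → Walk Adj (λ _ → ⊤) u v) ×
  (∀ (v : _) (vs : List _) → 2 ≤ length vs → Unique (v ∷ vs) →
     Linked (Edge Adj) (v ∷ vs ++ [ v ]) → ⊥)

-- [d]-vertex set of the subtree of G − v containing the vertex u
Piece : ∀ {d} → Permutation′ d → (ℤ → Fin d → Set) → Vtx d → Vtx d → Fin d → Set
Piece γ Adj v u x = Supp γ x × D-v x ≢ v × Walk Adj (λ w → w ≢ v) u (D-v x)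

-- CPP for s ∈ S': the [d]-vertex sets of the subtrees of G − s (one for each
-- neighbour ν of s) partition C_γ into consecutive pieces.
CPP : ∀ {d} → Permutation′ d → (ℤ → Fin d → Set) → ℤ → Set
CPP γ Adj s =
  (∀ x → Supp γ x → ∃[ ν ] (Adj s ν × Piece γ Adj (S-v s) (D-v ν) x)) ×
  (∀ ν ν′ x → Adj s ν → Adj s ν′ →
     Piece γ Adj (S-v s) (D-v ν) x → Piece γ Adj (S-v s) (D-v ν′) x → ν ≡ ν′) ×
  (∀ ν → Adj s ν → Consecutive γ (Piece γ Adj (S-v s) (D-v ν)))

-- x is met strictly before y when going counterclockwise from ν
-- (along γ⁻¹ ν, γ⁻² ν, …): the least k ≥ 1 with γ^k x = ν is smaller than
-- every k′ with γ^{k′} y = ν.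
CcwBefore : ∀ {d} → Permutation′ d → Fin d → Fin d → Fin d → Set
CcwBefore γ ν x y =
  ∃[ k ] (1 ≤ k × γ ^[ k ] x ≡ ν × (∀ k′ → 1 ≤ k′ → γ ^[ k′ ] y ≡ ν → k < k′))

-- CICPP for ν ∈ supp γ:
-- (a) the [d]-vertex sets of the subtrees of G − ν (one for each S-neighbour s of ν)
--     partition C_γ ∖ {ν} into consecutive pieces;
-- (b) ordered counterclockwise from ν, these pieces appear in increasing order of
--     the labels s of the corresponding S-neighbours.
CICPP : ∀ {d} → Permutation′ d → (ℤ → Fin d → Set) → Fin d → Set
CICPP γ Adj ν =
  (∀ x → Supp γ x → x ≢ ν → ∃[ s ] (Adj s ν × Piece γ Adj (D-v ν) (S-v s) x)) ×
  (∀ s s′ x → Adj s ν → Adj s′ ν →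
     Piece γ Adj (D-v ν) (S-v s) x → Piece γ Adj (D-v ν) (S-v s′) x → s ≡ s′) ×
  (∀ s → Adj s ν → Consecutive γ (Piece γ Adj (D-v ν) (S-v s))) ×
  (∀ s s′ x y → Adj s ν → Adj s′ ν → s ℤ.< s′ →
     Piece γ Adj (D-v ν) (S-v s) x → Piece γ Adj (D-v ν) (S-v s′) y →
     CcwBefore γ ν x y)

-- Let ν be a neighbour of s. Since G is a tree, the [d]-vertices of the
-- subtree of G − s containing ν are ν together with every [d]-vertex that
-- does not lie in the subtree of G − ν containing s. By CICPP of ν the latter
-- set is an arc of C_γ avoiding ν, and the complement of a proper arc in a
-- cycle is again an arc. The other two parts of CPP (the subtrees of G − s
-- cover supp γ and are disjoint) hold in every tree.
module Submission where

open import Defs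
open import Data.Nat
  using (ℕ; zero; suc; s≤s; z≤n; _+_; _*_; _∸_; _<_; _≤_; _<?_; _≤?_; NonZero; >-nonZero)
open import Data.Nat.Properties
  using (n<1+n; <⇒≤; ≤-<-trans; <-≤-trans; m∸n≤m; m<n⇒0<n∸m; m+[n∸m]≡n; m∸n+n≡m;
         m≤m*n; m≤n+m; ≤-trans; ≤-reflexive; ≮⇒≥; ≰⇒>; ∸-monoˡ-<; +-monoˡ-<; anyUpTo?)
open import Data.Nat.DivMod using (_%_; _/_; m≡m%n+[m/n]*n; m%n<n)
open import Data.Nat.Induction using (<-wellFounded)
open import Induction.WellFounded using (Acc; acc)
open import Data.Integer as ℤ using (ℤ; +_)
open import Data.Fin as Fin using (Fin; toℕ)
open import Data.Fin.Properties using (pigeonhole; toℕ-mono-<)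
open import Data.Fin.Permutation using (Permutation′; _⟨$⟩ʳ_)
open import Data.List using (List; []; _∷_; _++_; [_]; length)
open import Data.List.Relation.Unary.All as All using (All; []; _∷_)
open import Data.List.Relation.Unary.All.Properties using (¬Any⇒All¬)
open import Data.List.Relation.Unary.Any using (here; there)
open import Data.List.Relation.Unary.AllPairs using ([]; _∷_)
open import Data.List.Relation.Unary.Linked using (Linked; [-]; _∷_)
open import Data.List.Relation.Unary.Unique.Propositional using (Unique)
open import Data.List.Membership.Propositional using (_∈_)
open import Data.List.Membership.DecPropositional using () renaming (_∈?_ to ∈?-with)
open import Data.Product using (∃-syntax; _×_; _,_; proj₁; proj₂)
open import Data.Sum using (_⊎_; inj₁; inj₂)
open import Data.Empty using (⊥; ⊥-elim)
open import Function using (_∘_; _⇔_; mk⇔; Equivalence; Injection)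
open import Function.Properties.Inverse using (↔⇒↣)
open import Relation.Nullary using (¬_; yes; no; _×-dec_)
open import Relation.Unary using (Decidable)
open import Relation.Binary.Definitions using (DecidableEquality)
open import Relation.Binary.PropositionalEquality
  using (_≡_; _≢_; refl; sym; trans; cong; subst; ≢-sym; module ≡-Reasoning)

least-witness : {P : ℕ → Set} → Decidable P →
  ∀ n → P n → ∃[ k ] (P k × (∀ j → j < k → ¬ P j))
least-witness {P} P? n = go n (<-wellFounded n)
  where
  go : ∀ n → Acc _<_ n → P n → ∃[ k ] (P k × (∀ j → j < k → ¬ P j))
  go n (acc below) pn with anyUpTo? P? n
  ... | yes (k , k<n , pk) = go k (below k<n) pk
  ... | no none = n , pn , λ j j<n pj → none (j , j<n , pj)

module _ {d : ℕ} (γ : Permutation′ d) where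

  open ≡-Reasoning

  ^-+ : ∀ i k x → γ ^[ i + k ] x ≡ γ ^[ i ] (γ ^[ k ] x)
  ^-+ zero    k x = refl
  ^-+ (suc i) k x = cong (γ ⟨$⟩ʳ_) (^-+ i k x)

  ^-∸ˡ : ∀ {i j} x → i ≤ j → γ ^[ j ] x ≡ γ ^[ i ] (γ ^[ j ∸ i ] x)
  ^-∸ˡ {i} {j} x i≤j = trans (cong (λ k → γ ^[ k ] x) (sym (m+[n∸m]≡n i≤j))) (^-+ i (j ∸ i) x)

  ^-∸ʳ : ∀ {i j} x → i ≤ j → γ ^[ j ] x ≡ γ ^[ j ∸ i ] (γ ^[ i ] x)
  ^-∸ʳ {i} {j} x i≤j = trans (cong (λ k → γ ^[ k ] x) (sym (m∸n+n≡m i≤j))) (^-+ (j ∸ i) i x)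

  ^-injective : ∀ i {y z} → γ ^[ i ] y ≡ γ ^[ i ] z → y ≡ z
  ^-injective zero    eq = eq
  ^-injective (suc i) eq = ^-injective i (Injection.injective (↔⇒↣ γ) eq)

  Supp-^ : ∀ k {x} → Supp γ x → Supp γ (γ ^[ k ] x)
  Supp-^ zero    sx = sx
  Supp-^ (suc k) sx = Supp-^ k sx ∘ Injection.injective (↔⇒↣ γ)

  ^-*-fixed : ∀ {n x} → γ ^[ n ] x ≡ x → ∀ t → γ ^[ t * n ] x ≡ x
  ^-*-fixed         fix zero    = refl
  ^-*-fixed {n} {x} fix (suc t) = begin
    γ ^[ n + t * n ] x         ≡⟨ ^-+ n (t * n) x ⟩
    γ ^[ n ] (γ ^[ t * n ] x)  ≡⟨ cong (γ ^[ n ]_) (^-*-fixed fix t) ⟩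
    γ ^[ n ] x                 ≡⟨ fix ⟩
    x                          ∎

  ^-returns : ∀ x → ∃[ k ] (0 < k × γ ^[ k ] x ≡ x)
  ^-returns x with pigeonhole (n<1+n d) (λ i → γ ^[ toℕ i ] x)
  ... | i , j , i<j , eq =
    toℕ j ∸ toℕ i , m<n⇒0<n∸m i<j′ ,
    ^-injective (toℕ i) (trans (sym (^-∸ˡ x (<⇒≤ i<j′))) (sym eq))
    where
    i<j′ : toℕ i < toℕ j
    i<j′ = toℕ-mono-< i<j

  record MinimalPeriod (x : Fin d) : Set where
    field
      n       : ℕ
      {{n≢0}} : NonZero n
      fixed   : γ ^[ n ] x ≡ x
      minimal : ∀ m → 0 < m → m < n → γ ^[ m ] x ≢ x

  minimalPeriod : ∀ x → MinimalPeriod x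
  minimalPeriod x with ^-returns x
  ... | k , k>0 , fix with least-witness returns? k (k>0 , fix)
    where
    returns? : Decidable (λ k → 0 < k × γ ^[ k ] x ≡ x)
    returns? k = (0 <? k) ×-dec (γ ^[ k ] x Fin.≟ x)
  ... | n , (n>0 , fix′) , below = record
    { n = n ; n≢0 = >-nonZero n>0 ; fixed = fix′
    ; minimal = λ m m>0 m<n eq → below m m<n (m>0 , eq) }

  module _ {x : Fin d} (π : MinimalPeriod x) where

    open MinimalPeriod π

    ^-distinct : ∀ {i j} → i < j → j < n → γ ^[ i ] x ≢ γ ^[ j ] x
    ^-distinct {i} {j} i<j j<n eq =
      minimal (j ∸ i) (m<n⇒0<n∸m i<j) (≤-<-trans (m∸n≤m j i) j<n)
        (^-injective i (trans (sym (^-∸ˡ x (<⇒≤ i<j))) (sym eq)))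

    ^-% : ∀ j → γ ^[ j ] x ≡ γ ^[ j % n ] x
    ^-% j = begin
      γ ^[ j ] x                               ≡⟨ cong (λ k → γ ^[ k ] x) (m≡m%n+[m/n]*n j n) ⟩
      γ ^[ j % n + (j / n) * n ] x             ≡⟨ ^-+ (j % n) ((j / n) * n) x ⟩
      γ ^[ j % n ] (γ ^[ (j / n) * n ] x)      ≡⟨ cong (γ ^[ j % n ]_) (^-*-fixed fixed (j / n)) ⟩
      γ ^[ j % n ] x                           ∎

  -- From x = γ^p a, the remaining p n − p steps of p full periods lead back to a.
  IsCycle⇒reachable : IsCycle γ → ∀ {x y} → Supp γ x → Supp γ y → ∃[ j ] γ ^[ j ] x ≡ y
  IsCycle⇒reachable (a , _ , reach) {x} {y} sx sy with reach x sx | reach y sy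
  ... | p , a↦x | q , a↦y = q + p * n ∸ p , (begin
    γ ^[ q + p * n ∸ p ] x                  ≡⟨ cong (γ ^[ q + p * n ∸ p ]_) a↦x ⟨
    γ ^[ q + p * n ∸ p ] (γ ^[ p ] a)       ≡⟨ ^-∸ʳ a p≤q+pn ⟨
    γ ^[ q + p * n ] a                      ≡⟨ ^-+ q (p * n) a ⟩
    γ ^[ q ] (γ ^[ p * n ] a)               ≡⟨ cong (γ ^[ q ]_) (^-*-fixed fixed p) ⟩
    γ ^[ q ] a                              ≡⟨ a↦y ⟩
    y                                       ∎)
    where
    open MinimalPeriod (minimalPeriod a)
    p≤q+pn : p ≤ q + p * n
    p≤q+pn = ≤-trans (m≤m*n p n {{n≢0}}) (m≤n+m (p * n) q)

  IsCycle⇒reachable-within : IsCycle γ → ∀ {x y} (π : MinimalPeriod x) → Supp γ x → Supp γ y →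
    ∃[ j ] (j < MinimalPeriod.n π × γ ^[ j ] x ≡ y)
  IsCycle⇒reachable-within cyc π sx sy with IsCycle⇒reachable cyc sx sy
  ... | j , x↦y = j % n , m%n<n j n , trans (sym (^-% π j)) x↦y
    where
    open MinimalPeriod π

  Consecutive-complement : ∀ {P Q : Fin d → Set} → IsCycle γ → Consecutive γ P →
    ∀ {y} → Supp γ y → ¬ P y →
    (∀ x → Q x ⇔ (Supp γ x × ¬ P x)) → Consecutive γ Q
  Consecutive-complement {P} {Q} cyc (a₀ , m , sa₀ , _ , P⇔arc) sy ¬Py Q⇔
    = γ ^[ m ] a₀ , n ∸ m , Supp-^ m sa₀ , m<n⇒0<n∸m m<n ,
      λ x → mk⇔ (to x ∘ Equivalence.to (Q⇔ x)) (Equivalence.from (Q⇔ x) ∘ from x)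
    where
    π : MinimalPeriod a₀
    π = minimalPeriod a₀
    open MinimalPeriod π

    inArc : ∀ {j x} → j < m → γ ^[ j ] a₀ ≡ x → P x
    inArc j<m a₀↦x = Equivalence.from (P⇔arc _) (_ , j<m , a₀↦x)

    m<n : m < n
    m<n with m <? n
    ... | yes m<n = m<n
    ... | no m≮n with IsCycle⇒reachable-within cyc π sa₀ sy
    ...   | j , j<n , a₀↦y = ⊥-elim (¬Py (inArc (<-≤-trans j<n (≮⇒≥ m≮n)) a₀↦y))

    to : ∀ x → Supp γ x × ¬ P x → ∃[ k ] (k < n ∸ m × γ ^[ k ] (γ ^[ m ] a₀) ≡ x)
    to x (sx , ¬Px) with IsCycle⇒reachable-within cyc π sa₀ sx
    ... | j , j<n , a₀↦x with m ≤? j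
    ...   | yes m≤j = j ∸ m , ∸-monoˡ-< j<n m≤j , trans (sym (^-∸ʳ a₀ m≤j)) a₀↦x
    ...   | no m≰j = ⊥-elim (¬Px (inArc (≰⇒> m≰j) a₀↦x))

    from : ∀ x → ∃[ k ] (k < n ∸ m × γ ^[ k ] (γ ^[ m ] a₀) ≡ x) → Supp γ x × ¬ P x
    from x (k , k<n∸m , a↦x) = subst (Supp γ) a₀↦x (Supp-^ (k + m) sa₀) , ¬Px
      where
      a₀↦x : γ ^[ k + m ] a₀ ≡ x
      a₀↦x = trans (^-+ k m a₀) a↦x
      k+m<n : k + m < n
      k+m<n = <-≤-trans (+-monoˡ-< m k<n∸m) (≤-reflexive (m∸n+n≡m (<⇒≤ m<n)))
      ¬Px : ¬ P x
      ¬Px Px with Equivalence.to (P⇔arc x) Px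
      ... | i , i<m , a₀↦x′ =
        ^-distinct π (<-≤-trans i<m (m≤n+m m k)) k+m<n (trans a₀↦x′ (sym a₀↦x))

module _ {d : ℕ} {Adj : ℤ → Fin d → Set} where

  _≟ᵥ_ : DecidableEquality (Vtx d)
  S-v a ≟ᵥ S-v b with a ℤ.≟ b
  ... | yes refl = yes refl
  ... | no a≢b   = no λ { refl → a≢b refl }
  D-v a ≟ᵥ D-v b with a Fin.≟ b
  ... | yes refl = yes refl
  ... | no a≢b   = no λ { refl → a≢b refl }
  S-v _ ≟ᵥ D-v _ = no λ ()
  D-v _ ≟ᵥ S-v _ = no λ ()

  Edge-sym : ∀ {x y} → Edge Adj x y → Edge Adj y x
  Edge-sym {S-v _} {D-v _} e = e
  Edge-sym {D-v _} {S-v _} e = e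

  Edge⇒≢ : ∀ {x y} → Edge Adj x y → x ≢ y
  Edge⇒≢ {S-v _} {D-v _} _ ()
  Edge⇒≢ {D-v _} {S-v _} _ ()

  Walk-head : ∀ {P x y} → Walk Adj P x y → P x
  Walk-head (nil px)      = px
  Walk-head (cons px _ _) = px

  _++ʷ_ : ∀ {P x y z} → Walk Adj P x y → Walk Adj P y z → Walk Adj P x z
  nil _       ++ʷ w = w
  cons px e r ++ʷ w = cons px e (r ++ʷ w)

  Walk-reverse : ∀ {P x y} → Walk Adj P x y → Walk Adj P y x
  Walk-reverse (nil px)              = nil px
  Walk-reverse {x = x} (cons px e r) = Walk-reverse r ++ʷ cons (Walk-head r) (Edge-sym {x} e) (nil px)

  Walk-map : ∀ {P Q : Vtx d → Set} {x y} → (∀ {v} → P v → Q v) → Walk Adj P x y → Walk Adj Q x y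
  Walk-map f (nil px)      = nil (f px)
  Walk-map f (cons px e r) = cons (f px) e (Walk-map f r)

  Walk-lastVisit : ∀ {P u z} v → Walk Adj P u z → z ≢ v →
    Walk Adj (λ w → P w × w ≢ v) u z ⊎ ∃[ t ] (Edge Adj v t × Walk Adj (λ w → P w × w ≢ v) t z)
  Walk-lastVisit v (nil pz) z≢v = inj₁ (nil (pz , z≢v))
  Walk-lastVisit {u = u} v (cons pu e r) z≢v with Walk-lastVisit v r z≢v
  ... | inj₂ after = inj₂ after
  ... | inj₁ r′ with u ≟ᵥ v
  ...   | yes refl = inj₂ (_ , e , r′)
  ...   | no u≢v   = inj₁ (cons (pu , u≢v) e r′)

  -- vs lists the vertices of the path after its start u.
  data Path : Vtx d → Vtx d → List (Vtx d) → Set where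
    []  : ∀ {u} → Path u u []
    _∷_ : ∀ {u v w vs} → Edge Adj u v → Path v w vs → Path u w (v ∷ vs)

  SimplePath : (Vtx d → Set) → Vtx d → Vtx d → Set
  SimplePath P u w = ∃[ vs ] (Path u w vs × Unique (u ∷ vs) × All P (u ∷ vs))

  Path-suffix : ∀ {P u w x vs} → Path u w vs → Unique (u ∷ vs) → All P (u ∷ vs) →
    x ∈ u ∷ vs → SimplePath P x w
  Path-suffix p       un       al       (here refl) = _ , p , un , al
  Path-suffix (_ ∷ p) (_ ∷ un) (_ ∷ al) (there x∈) = Path-suffix p un al x∈

  Walk⇒SimplePath : ∀ {P u w} → Walk Adj P u w → SimplePath P u w
  Walk⇒SimplePath (nil pu) = [] , [] , [] ∷ [] , pu ∷ []
  Walk⇒SimplePath {u = u} (cons pu e r) with Walk⇒SimplePath r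
  ... | vs , p , un , al with ∈?-with _≟ᵥ_ u (_ ∷ vs)
  ...   | yes u∈ = Path-suffix p un al u∈
  ...   | no u∉  = _ ∷ vs , e ∷ p , ¬Any⇒All¬ _ u∉ ∷ un , pu ∷ al

  Path-linked : ∀ {u w v vs} → Path u w vs → Edge Adj w v → Linked (Edge Adj) (u ∷ vs ++ [ v ])
  Path-linked []       e = e ∷ [-]
  Path-linked (e′ ∷ p) e = e′ ∷ Path-linked p e

  Path-length : ∀ {u w vs} → Path u w vs → u ≢ w → 2 ≤ length (u ∷ vs)
  Path-length []      u≢w = ⊥-elim (u≢w refl)
  Path-length (_ ∷ _) _   = s≤s (s≤s z≤n)

  module _ {γ : Permutation′ d} {S' : List ℤ} (tree : IsTree γ S' Adj) where

    IsTree⇒noBypass : ∀ {v u w} → Edge Adj v u → Edge Adj w v → u ≢ w → ¬ Walk Adj (_≢ v) u w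
    IsTree⇒noBypass {v} v–u w–v u≢w bypass with Walk⇒SimplePath bypass
    ... | vs , p , un , al =
      proj₂ tree v _ (Path-length p u≢w) (All.map ≢-sym al ∷ un) (v–u ∷ Path-linked p w–v)

    Piece-cover : ∀ {v x} → InG γ S' v → Supp γ x → D-v x ≢ v →
      ∃[ t ] (Edge Adj v t × Piece γ Adj v t x)
    Piece-cover {v} {x} v∈G sx x≢v with Walk-lastVisit v (proj₁ tree v (D-v x) v∈G sx) x≢v
    ... | inj₁ avoiding      = ⊥-elim (proj₂ (Walk-head avoiding) refl)
    ... | inj₂ (t , v–t , w) = t , v–t , sx , x≢v , Walk-map proj₂ w

    Piece-unique : ∀ {v t t′ x} → Edge Adj v t → Edge Adj v t′ →
      Piece γ Adj v t x → Piece γ Adj v t′ x → t ≡ t′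
    Piece-unique {v} {t} {t′} v–t v–t′ (_ , _ , w) (_ , _ , w′) with t ≟ᵥ t′
    ... | yes t≡t′ = t≡t′
    ... | no t≢t′  = ⊥-elim (IsTree⇒noBypass v–t (Edge-sym {v} v–t′) t≢t′ (w ++ʷ Walk-reverse w′))

    Piece-exclusive : ∀ {v u x} → Edge Adj v u → Piece γ Adj v u x → ¬ Piece γ Adj u v x
    Piece-exclusive {v} {u} v–u (_ , x≢v , w) (_ , _ , w′) with Walk-lastVisit v w′ x≢v
    ... | inj₁ avoiding       = proj₂ (Walk-head avoiding) refl
    ... | inj₂ (t , v–t , w″) =
      IsTree⇒noBypass v–t (Edge-sym {v} v–u) (proj₁ (Walk-head w″)) (Walk-map proj₂ w″ ++ʷ Walk-reverse w)

    Piece-complement : ∀ {v u} → Edge Adj v u → InG γ S' u →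
      ∀ x → Piece γ Adj v u x ⇔ (Supp γ x × ¬ Piece γ Adj u v x)
    Piece-complement {v} {u} v–u u∈G x = mk⇔ (λ p → proj₁ p , Piece-exclusive v–u p) from
      where
      v≢u : v ≢ u
      v≢u = Edge⇒≢ v–u
      from : Supp γ x × ¬ Piece γ Adj u v x → Piece γ Adj v u x
      from (sx , ¬p) with D-v x ≟ᵥ v | D-v x ≟ᵥ u
      ... | yes refl | _        = ⊥-elim (¬p (sx , v≢u , nil v≢u))
      ... | no x≢v   | yes refl = sx , x≢v , nil (≢-sym v≢u)
      ... | no x≢v   | no x≢u with Piece-cover u∈G sx x≢u
      ...   | t , u–t , (_ , _ , w) with Walk-lastVisit v w x≢v
      ...     | inj₁ avoiding       = sx , x≢v , cons (≢-sym v≢u) u–t (Walk-map proj₂ avoiding)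
      ...     | inj₂ (t′ , v–t′ , w′) = ⊥-elim (¬p (sx , x≢u , cons v≢u v–t′ (Walk-map proj₁ w′)))

lemma4p3 : (d : ℕ) (S : ℤ → Set) (S' : List ℤ) (γ : Permutation′ d)
  (Adj : ℤ → Fin d → Set) →
  (∀ z → S z → (+ 0 ℤ.≤ z × z ℤ.≤ + d) → ⊥) →
  All S S' →
  IsCycle γ →
  (∀ s ν → Adj s ν → s ∈ S' × Supp γ ν) →
  IsTree γ S' Adj →
  (s : ℤ) → s ∈ S' →
  (∀ ν → Adj s ν → CICPP γ Adj ν) →
  CPP γ Adj s
lemma4p3 _ _ S' γ Adj _ _ cycle adjacent tree s s∈S' cicpp = cover , unique , consecutive
  where
  cover : ∀ x → Supp γ x → ∃[ ν ] (Adj s ν × Piece γ Adj (S-v s) (D-v ν) x)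
  cover x sx with Piece-cover tree {S-v s} s∈S' sx (λ ())
  ... | D-v ν , s–ν , p = ν , s–ν , p

  unique : ∀ ν ν′ x → Adj s ν → Adj s ν′ →
    Piece γ Adj (S-v s) (D-v ν) x → Piece γ Adj (S-v s) (D-v ν′) x → ν ≡ ν′
  unique ν ν′ x s–ν s–ν′ p p′ with Piece-unique tree {S-v s} s–ν s–ν′ p p′
  ... | refl = refl

  consecutive : ∀ ν → Adj s ν → Consecutive γ (Piece γ Adj (S-v s) (D-v ν))
  consecutive ν s–ν = Consecutive-complement γ cycle arc sν (λ p → proj₁ (proj₂ p) refl)
    (Piece-complement tree {S-v s} s–ν sν)
    where
    sν : Supp γ ν
    sν = proj₂ (adjacent s ν s–ν)
    arc : Consecutive γ (Piece γ Adj (D-v ν) (S-v s))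
    arc = proj₁ (proj₂ (proj₂ (cicpp ν s–ν))) s s–ν
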